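{- Let $G$ and $F\subseteq G$ be bipartite graphs on $U\cup Z$, let $\beta,\gamma\in Z$ be distinct, and let $G'=G^{\beta,\gamma}$ and $F'=F^{\beta,\gamma}$. Let $(s_v:v\in U)$ be natural numbers with $s_v\le d_G(v)$, and let $M$ and $M'$ be random subgraphs of $G$ and $G'$ respectively, with $M$ obtained by choosing the neighborhoods $N_M(v)$ ($v\in U$) independently, each uniform from the $s_v$-element subsets of $N_G(v)$, and $M'$ obtained similarly with $N_{G'}$ in place of $N_G$. Let $L=M\cap F$ and $L'=M'\cap F'$. Then $\mathbb{P}(L'\text{ admits a }U\text{ -perfect matching})\le\mathbb{P}(L\text{ admits a }U\text{ -perfect matching}).$
   Context: For a bipartite graph $B$ on $U\cup Z$ and distinct $\beta,\gamma\in Z$, $B^{\beta,\gamma}$ denotes the bipartite graph obtained from $B$ by replacing $N_B(\beta)$ by $N_B(\beta)\cup N_B(\gamma)$ and $N_B(\gamma)$ by $N_B(\beta)\cap N_B(\gamma)$. A $U$-perfect matching is a matching covering every vertex of $U$. -}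

module Defs where

open import Data.Nat using (ℕ; zero; suc; _≤_)
open import Data.Bool using (Bool; true; false; _∧_; _∨_; not; if_then_else_)
open import Data.Fin using (Fin; _≟_)
open import Data.Vec using (Vec; []; _∷_; lookup)
open import Data.List using (List; []; _∷_; map; concatMap; length; filterᵇ; allFin)
open import Data.Bool.ListAction using (all; any)
open import Relation.Nullary.Decidable using (⌊_⌋)

-- A bipartite graph on U ∪ Z with U = Fin m, Z = Fin n, given by its
-- adjacency relation: G u z ≡ true iff u ∈ U and z ∈ Z are adjacent.
BipGraph : ℕ → ℕ → Set
BipGraph m n = Fin m → Fin n → Bool

_⊆ᴳ_ : ∀ {m n} → BipGraph m n → BipGraph m n → Set
F ⊆ᴳ G = ∀ u z → F u z ≡ true → G u z ≡ true
  where open import Relation.Binary.PropositionalEquality using (_≡_)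

_∩ᴳ_ : ∀ {m n} → BipGraph m n → BipGraph m n → BipGraph m n
(A ∩ᴳ B) u z = A u z ∧ B u z

-- B^{β,γ}: N(β) := N(β) ∪ N(γ), N(γ) := N(β) ∩ N(γ), other z unchanged.
shift : ∀ {m n} → BipGraph m n → Fin n → Fin n → BipGraph m n
shift B β γ u z =
  if ⌊ z ≟ β ⌋ then (B u β ∨ B u γ)
  else (if ⌊ z ≟ γ ⌋ then (B u β ∧ B u γ) else B u z)

allᶠ : ∀ {k} → (Fin k → Bool) → Bool
allᶠ {k} p = all p (allFin k)

countᶠ : ∀ {k} → (Fin k → Bool) → ℕ
countᶠ {k} p = length (filterᵇ p (allFin k))

deg : ∀ {m n} → BipGraph m n → Fin m → ℕ
deg G v = countᶠ (G v)

allVecs : ∀ {A : Set} → List A → (k : ℕ) → List (Vec A k)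
allVecs xs zero = [] ∷ []
allVecs xs (suc k) = concatMap (λ x → map (x ∷_) (allVecs xs k)) xs

Subsetᶻ : ℕ → Set
Subsetᶻ n = Vec Bool n

allSubsets : (n : ℕ) → List (Subsetᶻ n)
allSubsets n = allVecs (true ∷ false ∷ []) n

-- An outcome of the random experiment: a choice of N_M(v) ⊆ Z for each v ∈ U.
Choice : ℕ → ℕ → Set
Choice m n = Vec (Subsetᶻ n) m

allChoices : (m n : ℕ) → List (Choice m n)
allChoices m n = allVecs (allSubsets n) m

graphOf : ∀ {m n} → Choice m n → BipGraph m n
graphOf N u z = lookup (lookup N u) z

-- N is a possible outcome for (G, s): each N(v) is an s_v-element subset of N_G(v).
-- The random M is uniform over these outcomes (independent uniform choices).
validChoice : ∀ {m n} → BipGraph m n → (Fin m → ℕ) → Choice m n → Bool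
validChoice G s N =
  allᶠ (λ v → allᶠ (λ z → not (graphOf N v z) ∨ G v z)
              ∧ ⌊ countᶠ (graphOf N v) Data.Nat.≟ s v ⌋)
  where import Data.Nat

injectiveᵇ : ∀ {m n} → Vec (Fin n) m → Bool
injectiveᵇ f = allᶠ (λ i → allᶠ (λ j → ⌊ i ≟ j ⌋ ∨ not ⌊ lookup f i ≟ lookup f j ⌋))

hasUPerfectMatching : ∀ {m n} → BipGraph m n → Bool
hasUPerfectMatching {m} {n} L =
  any (λ f → injectiveᵇ f ∧ allᶠ (λ u → L u (lookup f u))) (allVecs (allFin n) m)

goodCount : ∀ {m n} → BipGraph m n → BipGraph m n → (Fin m → ℕ) → ℕ
goodCount {m} {n} G F s =
  length (filterᵇ (λ N → validChoice G s N ∧ hasUPerfectMatching (graphOf N ∩ᴳ F))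
                  (allChoices m n))

totalCount : ∀ {m n} → BipGraph m n → (Fin m → ℕ) → ℕ
totalCount {m} {n} G s = length (filterᵇ (validChoice G s) (allChoices m n))

-- Couple the two experiments row by row: where G has γ but F lacks β, exchange the β- and
-- γ-entries of N(u). This matches outcomes for G with outcomes for G′, and turns L into L′ by
-- moving to β the γ-edges of the rows outside N_F(β). A U-perfect matching uses β and γ at most
-- once each, so whether the rest of L extends to one depends only on which rows take β and γ.
-- If L′ has a U-perfect matching but L has none, let W be the least set of rows adjacent in F
-- to both β and γ containing every such v that completes the rest of L at γ together with a
-- moved row or a row of W at β. Exchanging the β- and γ-entries of N on W gives an outcome in
-- which L has a matching and L′ has none. W is the same for the new outcome, so the exchange is
-- an involution of all outcomes mapping those where only L′ is matchable to those where only L is.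

module Submission where

open import Defs
open import Algebra.Definitions using (Involutive)
open import Data.Bool using (Bool; true; false; T; T?; _∧_; _∨_; not; if_then_else_)
open import Data.Bool.ListAction using (all)
open import Data.Bool.Properties using (T-≡; T-∧; T-∨; ∧-comm; ∨-comm; ∧-zeroʳ; ∨-identityʳ)
open import Data.Empty using (⊥-elim)
open import Data.Fin using (Fin; _≟_)
open import Data.Fin.Permutation.Components using (transpose)
open import Data.Fin.Properties using (any?)
open import Data.List
  using (List; []; _∷_; map; concatMap; length; filterᵇ; allFin; cartesianProductWith; _++_)
open import Data.List.Membership.Propositional using (_∈_; lose)
open import Data.List.Membership.Propositional.Properties
  using (∈-map⁺; ∈-allFin; ∈-cartesianProductWith⁺)
open import Data.List.Membership.Propositional.Properties.WithK using (unique∧set⇒bag)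
open import Data.List.Relation.Binary.BagAndSetEquality using (∼bag⇒↭)
open import Data.List.Relation.Binary.Permutation.Propositional using (_↭_)
open import Data.List.Relation.Binary.Permutation.Propositional.Properties using (filter-↭; ↭-length)
open import Data.List.Relation.Unary.All as All using ([]; _∷_)
open import Data.List.Relation.Unary.All.Properties using (all⁺; all⁻)
open import Data.List.Relation.Unary.AllPairs using ([]; _∷_)
open import Data.List.Relation.Unary.Any using (here; there; satisfied)
open import Data.List.Relation.Unary.Any.Properties using (any⁺; any⁻)
open import Data.List.Relation.Unary.Unique.Propositional using (Unique)
import Data.List.Relation.Unary.Unique.Propositional.Properties as Unique
open import Data.Maybe using (Maybe; just; nothing)
open import Data.Nat as ℕ using (ℕ; zero; suc; _≤_; _+_; _*_; z≤n; s≤s)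
open import Data.Nat.Properties
  using (≤-antisym; m≤n⇒m≤1+n; +-suc; +-mono-≤; *-monoˡ-≤; module ≤-Reasoning)
open import Data.Product using (Σ; _×_; _,_; proj₁; proj₂)
open import Data.Sum using (_⊎_; inj₁; inj₂; [_,_]′)
open import Data.Unit using (⊤; tt)
open import Data.Vec using (Vec; []; _∷_; lookup; tabulate)
open import Data.Vec.Properties using (∷-injective; lookup∘tabulate; tabulate∘lookup; tabulate-cong)
open import Function using (_∘_; id; _⇔_; mk⇔; Equivalence)
open import Relation.Binary.PropositionalEquality
  using (_≡_; _≢_; refl; sym; trans; cong; cong₂; subst; module ≡-Reasoning)
open import Relation.Nullary using (¬_; Dec; yes; no)
open import Relation.Nullary.Decidable using (⌊_⌋; toWitness; fromWitness)

open Equivalence using (to; from)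

private variable
  A : Set
  k : ℕ

T⇔→≡ : {a b : Bool} → (T a → T b) → (T b → T a) → a ≡ b
T⇔→≡ {false} {false} _ _ = refl
T⇔→≡ {false} {true}  _ b⇒a = ⊥-elim (b⇒a _)
T⇔→≡ {true}  {false} a⇒b _ = ⊥-elim (a⇒b _)
T⇔→≡ {true}  {true}  _ _ = refl

T-not : {b : Bool} → T (not b) ⇔ (¬ T b)
T-not {false} = mk⇔ (λ _ ()) _
T-not {true}  = mk⇔ (λ ()) (λ ¬t → ¬t _)

T-implies : {a b : Bool} → T (not a ∨ b) ⇔ (T a → T b)
T-implies {false} = mk⇔ (λ _ ()) _
T-implies {true}  = mk⇔ (λ b _ → b) (λ a⇒b → a⇒b _)

T-⌊⌋-implies : {B : Set} (a? : Dec A) (b? : Dec B) → T (⌊ b? ⌋ ∨ not ⌊ a? ⌋) ⇔ (A → B)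
T-⌊⌋-implies a?      (yes b) = mk⇔ (λ _ _ → b) _
T-⌊⌋-implies (yes a) (no ¬b) = mk⇔ (λ ()) (λ a⇒b → ¬b (a⇒b a))
T-⌊⌋-implies (no ¬a) (no ¬b) = mk⇔ (λ _ a → ⊥-elim (¬a a)) _

∧-of-⇒ : {a b : Bool} → (T a → T b) → a ∧ b ≡ a
∧-of-⇒ {false} _ = refl
∧-of-⇒ {true} {true}  _ = refl
∧-of-⇒ {true} {false} a⇒b = ⊥-elim (a⇒b _)

∨-of-⇒ : {a b : Bool} → (T a → T b) → a ∨ b ≡ b
∨-of-⇒ {false} _ = refl
∨-of-⇒ {true} {true}  _ = refl
∨-of-⇒ {true} {false} a⇒b = ⊥-elim (a⇒b _)

if-T : ∀ {b} {x y : A} → T b → (if b then x else y) ≡ x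
if-T {b = true} _ = refl

if-¬T : ∀ {b} {x y : A} → ¬ T b → (if b then x else y) ≡ y
if-¬T {b = false} _ = refl
if-¬T {b = true} ¬t = ⊥-elim (¬t _)

-- Counting over enumerations

count : (A → Bool) → List A → ℕ
count p xs = length (filterᵇ p xs)

count-mono : {p q : A → Bool} → (∀ x → T (p x) → T (q x)) → ∀ xs → count p xs ≤ count q xs
count-mono p⇒q [] = z≤n
count-mono {p = p} {q} p⇒q (x ∷ xs) with p x in px | q x in qx
... | true  | true  = s≤s (count-mono p⇒q xs)
... | true  | false = ⊥-elim (subst T qx (p⇒q x (subst T (sym px) _)))
... | false | true  = m≤n⇒m≤1+n (count-mono p⇒q xs)
... | false | false = count-mono p⇒q xs

count-cong : {p q : A → Bool} → (∀ x → p x ≡ q x) → ∀ xs → count p xs ≡ count q xs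
count-cong p≗q xs = ≤-antisym (count-mono (λ x → subst T (p≗q x)) xs)
                              (count-mono (λ x → subst T (sym (p≗q x))) xs)

count-split : (p q : A → Bool) → ∀ xs →
  count p xs ≡ count (λ x → p x ∧ q x) xs + count (λ x → p x ∧ not (q x)) xs
count-split p q [] = refl
count-split p q (x ∷ xs) with p x | q x
... | true  | true  = cong suc (count-split p q xs)
... | true  | false = trans (cong suc (count-split p q xs)) (sym (+-suc _ _))
... | false | _     = count-split p q xs

count-map : (p : A → Bool) (h : A → A) → ∀ xs → count p (map h xs) ≡ count (p ∘ h) xs
count-map p h [] = refl
count-map p h (x ∷ xs) with p (h x)
... | true  = cong suc (count-map p h xs)
... | false = count-map p h xs

module _ {xs : List A} (xs-unique : Unique xs) (xs-complete : ∀ x → x ∈ xs)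
         {h : A → A} (h-involutive : Involutive _≡_ h) where

  map-involution-↭ : map h xs ↭ xs
  map-involution-↭ = ∼bag⇒↭ (unique∧set⇒bag (Unique.map⁺ h-injective xs-unique) xs-unique
    (λ {x} → mk⇔ (λ _ → xs-complete x)
                 (λ _ → subst (_∈ map h xs) (h-involutive x) (∈-map⁺ h (xs-complete (h x))))))
    where
    h-injective : ∀ {x y} → h x ≡ h y → x ≡ y
    h-injective {x} {y} hx≡hy = trans (sym (h-involutive x)) (trans (cong h hx≡hy) (h-involutive y))

  count-involution : (p : A → Bool) → count p xs ≡ count (p ∘ h) xs
  count-involution p = trans (sym (↭-length (filter-↭ (T? ∘ p) map-involution-↭))) (count-map p h xs)

  count-≤-involution : (a b : A → Bool) →
    (∀ x → T (a x ∧ not (b x)) → T (b (h x) ∧ not (a (h x)))) → count a xs ≤ count b xs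
  count-≤-involution a b a∖b⇒b∖a = begin
    count a xs
      ≡⟨ count-split a b xs ⟩
    count (λ x → a x ∧ b x) xs + count (λ x → a x ∧ not (b x)) xs
      ≡⟨ cong (count (λ x → a x ∧ b x) xs +_) (count-involution (λ x → a x ∧ not (b x))) ⟩
    count (λ x → a x ∧ b x) xs + count (λ x → a (h x) ∧ not (b (h x))) xs
      ≤⟨ +-mono-≤ (count-mono (λ x → subst T (∧-comm (a x) (b x))) xs) (count-mono moved xs) ⟩
    count (λ x → b x ∧ a x) xs + count (λ x → b x ∧ not (a x)) xs
      ≡⟨ count-split b a xs ⟨
    count b xs
      ∎
    where
    open ≤-Reasoning
    moved : ∀ x → T (a (h x) ∧ not (b (h x))) → T (b x ∧ not (a x))
    moved x = subst (λ y → T (b y ∧ not (a y))) (h-involutive x) ∘ a∖b⇒b∖a (h x)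

allᶠ⇔ : {p : Fin k → Bool} → T (allᶠ p) ⇔ (∀ i → T (p i))
allᶠ⇔ {k} {p} = mk⇔ (λ t i → All.lookup (all⁺ p (allFin k) t) (∈-allFin i))
                    (λ t → all⁻ p {allFin k} (All.tabulate (λ {i} _ → t i)))

allᶠ-cong : {p q : Fin k → Bool} → (∀ i → p i ≡ q i) → allᶠ p ≡ allᶠ q
allᶠ-cong p≗q = T⇔→≡
  (λ t → from allᶠ⇔ λ i → subst T (p≗q i) (to allᶠ⇔ t i))
  (λ t → from allᶠ⇔ λ i → subst T (sym (p≗q i)) (to allᶠ⇔ t i))

module _ {π : Fin k → Fin k} (π-involutive : Involutive _≡_ π) where

  allᶠ-involution : (p : Fin k → Bool) → allᶠ p ≡ allᶠ (p ∘ π)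
  allᶠ-involution p = T⇔→≡
    (λ t → from allᶠ⇔ λ i → to allᶠ⇔ t (π i))
    (λ t → from allᶠ⇔ λ i → subst (T ∘ p) (π-involutive i) (to allᶠ⇔ t (π i)))

  countᶠ-involution : (p : Fin k → Bool) → countᶠ p ≡ countᶠ (p ∘ π)
  countᶠ-involution = count-involution (Unique.allFin⁺ k) ∈-allFin π-involutive

concatMap-map≡cartesianProductWith : {B C : Set} (f : A → B → C) (xs : List A) (ys : List B) →
  concatMap (λ x → map (f x) ys) xs ≡ cartesianProductWith f xs ys
concatMap-map≡cartesianProductWith f [] ys = refl
concatMap-map≡cartesianProductWith f (x ∷ xs) ys =
  cong (map (f x) ys ++_) (concatMap-map≡cartesianProductWith f xs ys)

allVecs-unique : {xs : List A} → Unique xs → ∀ k → Unique (allVecs xs k)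
allVecs-unique xs-unique zero = [] ∷ []
allVecs-unique {xs = xs} xs-unique (suc k) =
  subst Unique (sym (concatMap-map≡cartesianProductWith _∷_ xs (allVecs xs k)))
    (Unique.cartesianProductWith⁺ _∷_ ∷-injective xs-unique (allVecs-unique xs-unique k))

∈-allVecs : {xs : List A} → (∀ x → x ∈ xs) → (v : Vec A k) → v ∈ allVecs xs k
∈-allVecs xs-complete [] = here refl
∈-allVecs {xs = xs} xs-complete (_∷_ {n = k} x v) =
  subst ((x ∷ v) ∈_) (sym (concatMap-map≡cartesianProductWith _∷_ xs (allVecs xs k)))
    (∈-cartesianProductWith⁺ _∷_ (xs-complete x) (∈-allVecs xs-complete v))

∈-allSubsets : (X : Vec Bool k) → X ∈ allSubsets k
∈-allSubsets = ∈-allVecs λ where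
  true  → here refl
  false → there (here refl)

allChoices-unique : ∀ {m n} → Unique (allChoices m n)
allChoices-unique {m} {n} = allVecs-unique (allVecs-unique (((λ ()) ∷ []) ∷ [] ∷ []) n) m

∈-allChoices : ∀ {m n} (N : Choice m n) → N ∈ allChoices m n
∈-allChoices = ∈-allVecs ∈-allSubsets

-- Least closed sets

module LeastClosed {m : ℕ} (S : Fin m → Bool) (E : Fin m → Fin m → Bool) where

  Closed : (Fin m → Bool) → Set
  Closed X = ∀ u v → T (S u ∨ X u) → T (E u v) → T (X v)

  closed? : Vec Bool m → Bool
  closed? X = allᶠ λ u → allᶠ λ v → not ((S u ∨ lookup X u) ∧ E u v) ∨ lookup X v

  closed?⇔ : (X : Vec Bool m) → T (closed? X) ⇔ Closed (lookup X)
  closed?⇔ X = mk⇔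
    (λ c u v s e → to T-implies (to allᶠ⇔ (to allᶠ⇔ c u) v) (from T-∧ (s , e)))
    (λ c → from allᶠ⇔ λ u → from allᶠ⇔ λ v → from T-implies λ se →
       let s , e = to T-∧ se in c u v s e)

  least : Fin m → Bool
  least w = all (λ X → not (closed? X) ∨ lookup X w) (allSubsets m)

  Closed-resp : ∀ {X Y} → (∀ u → X u ≡ Y u) → Closed X → Closed Y
  Closed-resp {X} {Y} X≗Y X-closed u v s e =
    subst T (X≗Y v) (X-closed u v (subst (λ b → T (S u ∨ b)) (sym (X≗Y u)) s) e)

  least-minimal : ∀ {X} → Closed X → ∀ w → T (least w) → T (X w)
  least-minimal {X} X-closed w w∈least =
    subst T (lookup∘tabulate X w)
      (to T-implies (All.lookup (all⁺ _ (allSubsets m) w∈least) (∈-allSubsets (tabulate X)))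
        (from (closed?⇔ (tabulate X)) (Closed-resp (λ u → sym (lookup∘tabulate X u)) X-closed)))

  least-closed : Closed least
  least-closed u v s∨least e = all⁻ _ (All.tabulate λ {X} X∈ → from T-implies λ c →
    to (closed?⇔ X) c u v
      ([ from T-∨ ∘ inj₁
       , (λ w → from T-∨ (inj₂ (to T-implies (All.lookup (all⁺ _ (allSubsets m) w) X∈) c))) ]′
       (to T-∨ s∨least)) e)

Closed-cong : ∀ {m} {S S′ : Fin m → Bool} {E E′ : Fin m → Fin m → Bool} →
  (∀ u → S u ≡ S′ u) → (∀ u v → E u v ≡ E′ u v) →
  ∀ {X} → LeastClosed.Closed S′ E′ X → LeastClosed.Closed S E X
Closed-cong {S = S} S≗S′ E≗E′ {X} X-closed u v s e =
  X-closed u v (subst (λ b → T (b ∨ X u)) (S≗S′ u) s) (subst T (E≗E′ u v) e)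

least-cong : ∀ {m} {S S′ : Fin m → Bool} {E E′ : Fin m → Fin m → Bool} →
  (∀ u → S u ≡ S′ u) → (∀ u v → E u v ≡ E′ u v) →
  ∀ w → LeastClosed.least S E w ≡ LeastClosed.least S′ E′ w
least-cong {S = S} {S′} {E} {E′} S≗S′ E≗E′ w = T⇔→≡
  (least-minimal S E (Closed-cong S≗S′ E≗E′ (least-closed S′ E′)) w)
  (least-minimal S′ E′ (Closed-cong (sym ∘ S≗S′) (λ u v → sym (E≗E′ u v)) (least-closed S E)) w)
  where open LeastClosed

-- The exchange argument

module _ {m : ℕ} where

  _∈ᵒ_ : Maybe (Fin m) → (Fin m → Bool) → Set
  nothing ∈ᵒ P = ⊤
  just u  ∈ᵒ P = T (P u)

  ∈ᵒ-mono : ∀ {P Q : Fin m → Bool} → (∀ u → T (P u) → T (Q u)) → ∀ o → o ∈ᵒ P → o ∈ᵒ Q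
  ∈ᵒ-mono P⊆Q nothing  _ = tt
  ∈ᵒ-mono P⊆Q (just u) = P⊆Q u

  -- K o₁ o₂ tells whether the rest of a graph extends to a U-perfect matching in which o₁ is
  -- matched to β and o₂ to γ, nothing meaning that the column stays unmatched.
  record Completable (K : Maybe (Fin m) → Maybe (Fin m) → Bool) (P Q : Fin m → Bool) : Set where
    constructor completion
    field
      {β-partner γ-partner} : Maybe (Fin m)
      β-partner∈P : β-partner ∈ᵒ P
      γ-partner∈Q : γ-partner ∈ᵒ Q
      completes : T (K β-partner γ-partner)

-- With p the β-column of F and P, Q the β- and γ-columns of L, these are the columns of L′
-- under the coupling of the two experiments: the shift moves the γ-edges of rows outside p to β.
module _ {m : ℕ} (p : Fin m → Bool) where

  shiftColumnβ : (P Q : Fin m → Bool) → Fin m → Bool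
  shiftColumnβ P Q u = P u ∨ (not (p u) ∧ Q u)

  shiftColumnγ : (Q : Fin m → Bool) → Fin m → Bool
  shiftColumnγ Q u = p u ∧ Q u

module Exchange {m : ℕ} (K : Maybe (Fin m) → Maybe (Fin m) → Bool) (p q : Fin m → Bool) where

  movable : (Q : Fin m → Bool) → Fin m → Bool
  movable Q u = not (p u) ∧ Q u

  exchangeable : (P Q : Fin m → Bool) → Fin m → Bool
  exchangeable P Q u = p u ∧ q u ∧ (P u ∨ Q u)

  step : (P Q : Fin m → Bool) → Fin m → Fin m → Bool
  step P Q u v = exchangeable P Q v ∧ K (just u) (just v)

  exchangeSet : (P Q : Fin m → Bool) → Fin m → Bool
  exchangeSet P Q = LeastClosed.least (movable Q) (step P Q)

  exchangeβ exchangeγ : (P Q : Fin m → Bool) → Fin m → Bool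
  exchangeβ P Q u = if exchangeSet P Q u then Q u else P u
  exchangeγ P Q u = if exchangeSet P Q u then P u else Q u

  module _ (P Q : Fin m → Bool) where
    open LeastClosed (movable Q) (step P Q)

    exchangeSet⊆exchangeable : ∀ u → T (exchangeSet P Q u) → T (exchangeable P Q u)
    exchangeSet⊆exchangeable = least-minimal (λ u v _ s → proj₁ (to T-∧ s))

    exchangeSet⊆p : ∀ u → T (exchangeSet P Q u) → T (p u)
    exchangeSet⊆p u = proj₁ ∘ to T-∧ ∘ exchangeSet⊆exchangeable u

    exchangeSet-exchange : ∀ u → exchangeSet (exchangeβ P Q) (exchangeγ P Q) u ≡ exchangeSet P Q u
    exchangeSet-exchange = least-cong movable-unchanged
      (λ u v → cong (_∧ K (just u) (just v)) (exchangeable-unchanged v))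
      where
      movable-unchanged : ∀ u → movable (exchangeγ P Q) u ≡ movable Q u
      movable-unchanged u with exchangeSet P Q u in w
      ... | false = refl
      ... | true rewrite to T-≡ (exchangeSet⊆p u (subst T (sym w) tt)) = refl
      exchangeable-unchanged : ∀ u → exchangeable (exchangeβ P Q) (exchangeγ P Q) u ≡ exchangeable P Q u
      exchangeable-unchanged u with exchangeSet P Q u
      ... | false = refl
      ... | true  = cong (λ b → p u ∧ q u ∧ b) (∨-comm (Q u) (P u))

  module _ (K-sym : ∀ o o′ → K o o′ ≡ K o′ o) {P Q : Fin m → Bool}
           (Q⊆q : ∀ u → T (Q u) → T (q u)) (¬completable : ¬ Completable K P Q) where
    private
      W = exchangeSet P Q
    open LeastClosed (movable Q) (step P Q)

    ¬completable-sym : ∀ {o₁ o₂} → o₁ ∈ᵒ Q → o₂ ∈ᵒ P → ¬ T (K o₁ o₂)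
    ¬completable-sym {o₁} {o₂} o₁∈Q o₂∈P k =
      ¬completable (completion o₂∈P o₁∈Q (subst T (K-sym o₁ o₂) k))

    exchangeSet⊆Q∖P : ∀ u → T (W u) → T (Q u) × ¬ T (P u)
    exchangeSet⊆Q∖P u u∈W = Q∖P (least-minimal Q∖P-closed u u∈W)
      where
      Q∖P : ∀ {u} → T (exchangeable P Q u ∧ not (P u)) → T (Q u) × ¬ T (P u)
      Q∖P {u} t with p u | q u | P u | Q u
      ... | true | true | false | true = tt , λ ()
      Q∖P-closed : Closed (λ u → exchangeable P Q u ∧ not (P u))
      Q∖P-closed u v s e = from T-∧ (v-exchangeable , from T-not λ v∈P → ¬completable-sym u∈Q v∈P uv)
        where
        v-exchangeable = proj₁ (to T-∧ e)
        uv = proj₂ (to T-∧ e)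
        u∈Q : T (Q u)
        u∈Q = [ proj₂ ∘ to (T-∧ {not (p u)}) , proj₁ ∘ Q∖P ]′ (to T-∨ s)

    shiftColumnγ⊆Q : ∀ u → T (shiftColumnγ p Q u) → T (Q u)
    shiftColumnγ⊆Q u = proj₂ ∘ to (T-∧ {p u})

    movable⊆Q : ∀ u → T (movable Q u) → T (Q u)
    movable⊆Q u = proj₂ ∘ to (T-∧ {not (p u)})

    exchanged-completable : Completable K (shiftColumnβ p P Q) (shiftColumnγ p Q) →
                           Completable K (exchangeβ P Q) (exchangeγ P Q)
    exchanged-completable (completion {nothing} {o₂} _ o₂∈ k) =
      ⊥-elim (¬completable (completion _ (∈ᵒ-mono shiftColumnγ⊆Q o₂ o₂∈) k))
    exchanged-completable (completion {just c} {o₂} c∈ o₂∈ k) with to (T-∨ {P c}) c∈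
    ... | inj₁ c∈P = ⊥-elim (¬completable (completion c∈P (∈ᵒ-mono shiftColumnγ⊆Q o₂ o₂∈) k))
    ... | inj₂ c-movable with o₂ | o₂∈
    ...   | nothing | _ = ⊥-elim (¬completable-sym (movable⊆Q c c-movable) _ k)
    ...   | just y  | y∈ = completion (subst T (sym (if-T y∈W)) y∈Q) (subst T (sym (if-¬T c∉W)) c∈Q)
                                 (subst T (K-sym (just c) (just y)) k)
      where
      c∈Q : T (Q c)
      c∈Q = movable⊆Q c c-movable
      c∉W : ¬ T (W c)
      c∉W c∈W = to T-not (proj₁ (to (T-∧ {not (p c)}) c-movable)) (exchangeSet⊆p P Q c c∈W)
      y∈p : T (p y)
      y∈p = proj₁ (to (T-∧ {p y}) y∈)
      y∈Q : T (Q y)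
      y∈Q = shiftColumnγ⊆Q y y∈
      y∈W : T (W y)
      y∈W = least-closed c y (from T-∨ (inj₁ c-movable))
        (from T-∧ (from T-∧ (y∈p , from T-∧ (Q⊆q y y∈Q , from (T-∨ {P y}) (inj₂ y∈Q))) , k))

    movable∪exchangeSet⊆Q : ∀ u → T (movable Q u ∨ W u) → T (Q u)
    movable∪exchangeSet⊆Q u = [ movable⊆Q u , proj₁ ∘ exchangeSet⊆Q∖P u ]′ ∘ to T-∨

    shiftColumnβ-exchanged⊆ : ∀ u → T (shiftColumnβ p (exchangeβ P Q) (exchangeγ P Q) u) →
                              T (movable Q u ∨ W u) ⊎ T (P u)
    shiftColumnβ-exchanged⊆ u t with exchangeSet P Q u
    ... | true  = inj₁ (from (T-∨ {movable Q u}) (inj₂ _))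
    ... | false = [ inj₂ , inj₁ ∘ from T-∨ ∘ inj₁ ]′ (to (T-∨ {P u}) t)

    shiftColumnγ-exchanged⊆ : ∀ w → T (shiftColumnγ p (exchangeγ P Q) w) →
                              T (exchangeable P Q w) × T (Q w) × ¬ T (W w)
    shiftColumnγ-exchanged⊆ w t with exchangeSet P Q w in w∈W
    ... | true  = ⊥-elim (proj₂ (exchangeSet⊆Q∖P w (subst T (sym w∈W) _)) (proj₂ (to (T-∧ {p w}) t)))
    ... | false = from T-∧ (w∈p , from T-∧ (Q⊆q w w∈Q , from (T-∨ {P w}) (inj₂ w∈Q))) , w∈Q , λ ()
      where
      w∈p = proj₁ (to (T-∧ {p w}) t)
      w∈Q = proj₂ (to (T-∧ {p w}) t)

    shifted-exchanged-not-completable :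
      ¬ Completable K (shiftColumnβ p (exchangeβ P Q) (exchangeγ P Q)) (shiftColumnγ p (exchangeγ P Q))
    shifted-exchanged-not-completable (completion {nothing} {nothing} _ _ k) = ¬completable (completion _ _ k)
    shifted-exchanged-not-completable (completion {just u} {nothing} u∈ _ k) with shiftColumnβ-exchanged⊆ u u∈
    ... | inj₁ u-seed = ¬completable-sym (movable∪exchangeSet⊆Q u u-seed) _ k
    ... | inj₂ u∈P    = ¬completable (completion u∈P _ k)
    shifted-exchanged-not-completable (completion {nothing} {just w} _ w∈ k) =
      ¬completable (completion _ (proj₁ (proj₂ (shiftColumnγ-exchanged⊆ w w∈))) k)
    shifted-exchanged-not-completable (completion {just u} {just w} u∈ w∈ k)
      with shiftColumnβ-exchanged⊆ u u∈ | shiftColumnγ-exchanged⊆ w w∈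
    ... | inj₁ u-seed | w-exchangeable , _ , w∉W =
      w∉W (least-closed u w u-seed (from T-∧ (w-exchangeable , k)))
    ... | inj₂ u∈P    | _ , w∈Q , _ = ¬completable (completion u∈P w∈Q k)

exchangeSet-cong : ∀ {m} {K K′ : Maybe (Fin m) → Maybe (Fin m) → Bool} {p q P P′ Q Q′ : Fin m → Bool} →
  (∀ o o′ → K o o′ ≡ K′ o o′) → (∀ u → P u ≡ P′ u) → (∀ u → Q u ≡ Q′ u) →
  ∀ u → Exchange.exchangeSet K p q P Q u ≡ Exchange.exchangeSet K′ p q P′ Q′ u
exchangeSet-cong {p = p} {q} K≗K′ P≗P′ Q≗Q′ = least-cong
  (λ u → cong (not (p u) ∧_) (Q≗Q′ u))
  (λ u v → cong₂ (λ e k → (p v ∧ q v ∧ e) ∧ k) (cong₂ _∨_ (P≗P′ v) (Q≗Q′ v))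
                 (K≗K′ (just u) (just v)))

Completable-cong : ∀ {m} {K K′ : Maybe (Fin m) → Maybe (Fin m) → Bool} {P P′ Q Q′ : Fin m → Bool} →
  (∀ o o′ → K o o′ ≡ K′ o o′) → (∀ u → P u ≡ P′ u) → (∀ u → Q u ≡ Q′ u) →
  Completable K P Q → Completable K′ P′ Q′
Completable-cong K≗K′ P≗P′ Q≗Q′ (completion {o₁} {o₂} o₁∈P o₂∈Q k) =
  completion (∈ᵒ-mono (λ u → subst T (P≗P′ u)) o₁ o₁∈P) (∈ᵒ-mono (λ u → subst T (Q≗Q′ u)) o₂ o₂∈Q)
             (subst T (K≗K′ o₁ o₂) k)

-- U-perfect matchings

injectiveᵇ⇔ : ∀ {m n} {f : Vec (Fin n) m} → T (injectiveᵇ f) ⇔ (∀ i j → lookup f i ≡ lookup f j → i ≡ j)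
injectiveᵇ⇔ {f = f} = mk⇔
  (λ t i j → to (T-⌊⌋-implies (lookup f i ≟ lookup f j) (i ≟ j)) (to allᶠ⇔ (to allᶠ⇔ t i) j))
  (λ inj → from allᶠ⇔ λ i → from allᶠ⇔ λ j →
     from (T-⌊⌋-implies (lookup f i ≟ lookup f j) (i ≟ j)) (inj i j))

record UPerfectMatching {m n} (L : BipGraph m n) : Set where
  constructor matching
  field
    partner : Fin m → Fin n
    partner-injective : ∀ u v → partner u ≡ partner v → u ≡ v
    partner-adjacent : ∀ u → T (L u (partner u))

module _ {m n} {L : BipGraph m n} where

  hasUPerfectMatching⇔ : T (hasUPerfectMatching L) ⇔ UPerfectMatching L
  hasUPerfectMatching⇔ = mk⇔ extract insert
    where
    extract : T (hasUPerfectMatching L) → UPerfectMatching L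
    extract t with satisfied (any⁻ _ (allVecs (allFin n) m) t)
    ... | f , ok = matching (lookup f) (to (injectiveᵇ⇔ {f = f}) (proj₁ (to (T-∧ {injectiveᵇ f}) ok)))
                                        (to allᶠ⇔ (proj₂ (to (T-∧ {injectiveᵇ f}) ok)))
    insert : UPerfectMatching L → T (hasUPerfectMatching L)
    insert (matching f f-injective f-adjacent) = any⁺ _ (lose (∈-allVecs ∈-allFin (tabulate f))
      (from T-∧ ( from (injectiveᵇ⇔ {f = tabulate f})
                    (λ i j e → f-injective i j (trans (sym (lookup∘tabulate f i)) (trans e (lookup∘tabulate f j))))
                , from allᶠ⇔ (λ u → subst (T ∘ L u) (sym (lookup∘tabulate f u)) (f-adjacent u)))))

UPerfectMatching-mono : ∀ {m n} {L L′ : BipGraph m n} → (∀ u z → T (L u z) → T (L′ u z)) →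
                        UPerfectMatching L → UPerfectMatching L′
UPerfectMatching-mono L⊆L′ (matching f f-injective f-adjacent) =
  matching f f-injective (λ u → L⊆L′ u (f u) (f-adjacent u))

⁅_⁆ᵒ : ∀ {m} → Maybe (Fin m) → Fin m → Bool
⁅ nothing ⁆ᵒ v = false
⁅ just u  ⁆ᵒ v = ⌊ v ≟ u ⌋

∈ᵒ⇔⁅⁆ᵒ⊆ : ∀ {m} (o : Maybe (Fin m)) {P : Fin m → Bool} → o ∈ᵒ P ⇔ (∀ u → T (⁅ o ⁆ᵒ u) → T (P u))
∈ᵒ⇔⁅⁆ᵒ⊆ nothing = mk⇔ (λ _ _ ()) _
∈ᵒ⇔⁅⁆ᵒ⊆ (just u) {P} = mk⇔ (λ u∈P v v≡u → subst (T ∘ P) (sym (toWitness v≡u)) u∈P)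
                                (λ ⁅u⁆⊆P → ⁅u⁆⊆P u (fromWitness refl))

preimage : ∀ {m n} (f : Fin m → Fin n) → (∀ u v → f u ≡ f v → u ≡ v) → (z : Fin n) →
  Σ (Maybe (Fin m)) λ o → (∀ u → f u ≡ z → T (⁅ o ⁆ᵒ u)) × (∀ u → T (⁅ o ⁆ᵒ u) → f u ≡ z)
preimage f f-injective z with any? (λ u → f u ≟ z)
... | yes (u , fu≡z) = just u , (λ v fv≡z → fromWitness (f-injective v u (trans fv≡z (sym fu≡z))))
                              , (λ v v≡u → subst (λ w → f w ≡ z) (sym (toWitness v≡u)) fu≡z)
... | no ∄u = nothing , (λ v fv≡z → ⊥-elim (∄u (v , fv≡z))) , (λ _ ())

graphOf-injective : ∀ {m n} {N N′ : Choice m n} → (∀ u z → graphOf N u z ≡ graphOf N′ u z) → N ≡ N′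
graphOf-injective {N = N} {N′} N≗N′ = begin
  N                                           ≡⟨ tabulate∘lookup N ⟨
  tabulate (λ u → lookup N u)                 ≡⟨ tabulate-cong (λ u → row u) ⟩
  tabulate (λ u → lookup N′ u)                ≡⟨ tabulate∘lookup N′ ⟩
  N′                                          ∎
  where
  open ≡-Reasoning
  row : ∀ u → lookup N u ≡ lookup N′ u
  row u = trans (sym (tabulate∘lookup (lookup N u)))
                (trans (tabulate-cong (N≗N′ u)) (tabulate∘lookup (lookup N′ u)))

module Columns {n : ℕ} (β γ : Fin n) (β≢γ : β ≢ γ) where

  data Column : Fin n → Set where
    β-column : Column β
    γ-column : Column γ
    other-column : ∀ {z} → z ≢ β → z ≢ γ → Column z

  column : ∀ z → Column z
  column z with z ≟ β | z ≟ γ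
  ... | yes refl | _        = β-column
  ... | no _     | yes refl = γ-column
  ... | no z≢β   | no z≢γ   = other-column z≢β z≢γ

  setColumns : ∀ {m} → BipGraph m n → (P Q : Fin m → Bool) → BipGraph m n
  setColumns R P Q u z = if ⌊ z ≟ β ⌋ then P u else (if ⌊ z ≟ γ ⌋ then Q u else R u z)

  module _ {m} (R : BipGraph m n) (P Q : Fin m → Bool) (u : Fin m) where

    setColumns-β : setColumns R P Q u β ≡ P u
    setColumns-β with β ≟ β
    ... | yes _   = refl
    ... | no β≢β = ⊥-elim (β≢β refl)

    setColumns-γ : setColumns R P Q u γ ≡ Q u
    setColumns-γ with γ ≟ β | γ ≟ γ
    ... | yes γ≡β | _       = ⊥-elim (β≢γ (sym γ≡β))
    ... | no _    | yes _   = refl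
    ... | no _    | no γ≢γ = ⊥-elim (γ≢γ refl)

    setColumns-other : ∀ {z} → z ≢ β → z ≢ γ → setColumns R P Q u z ≡ R u z
    setColumns-other {z} z≢β z≢γ with z ≟ β | z ≟ γ
    ... | yes z≡β | _       = ⊥-elim (z≢β z≡β)
    ... | no _    | yes z≡γ = ⊥-elim (z≢γ z≡γ)
    ... | no _    | no _    = refl

  τ : Fin n → Fin n
  τ = transpose β γ

  τ-β : τ β ≡ γ
  τ-β with β ≟ β
  ... | yes _   = refl
  ... | no β≢β = ⊥-elim (β≢β refl)

  τ-γ : τ γ ≡ β
  τ-γ with γ ≟ β
  ... | yes γ≡β = ⊥-elim (β≢γ (sym γ≡β))
  ... | no _ with γ ≟ γ
  ...   | yes _   = refl
  ...   | no γ≢γ = ⊥-elim (γ≢γ refl)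

  τ-other : ∀ {z} → z ≢ β → z ≢ γ → τ z ≡ z
  τ-other {z} z≢β z≢γ with z ≟ β
  ... | yes z≡β = ⊥-elim (z≢β z≡β)
  ... | no _ with z ≟ γ
  ...   | yes z≡γ = ⊥-elim (z≢γ z≡γ)
  ...   | no _    = refl

  τ-involutive : ∀ z → τ (τ z) ≡ z
  τ-involutive z with column z
  ... | β-column = trans (cong τ τ-β) τ-γ
  ... | γ-column = trans (cong τ τ-γ) τ-β
  ... | other-column z≢β z≢γ = trans (cong τ (τ-other z≢β z≢γ)) (τ-other z≢β z≢γ)

  module _ {m} {R R′ : BipGraph m n} {P P′ Q Q′ : Fin m → Bool} where

    setColumns-⊆ : ∀ u z → (z ≡ β → T (P u) → T (P′ u)) → (z ≡ γ → T (Q u) → T (Q′ u)) →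
      (z ≢ β → z ≢ γ → T (R u z) → T (R′ u z)) → T (setColumns R P Q u z) → T (setColumns R′ P′ Q′ u z)
    setColumns-⊆ u z P⇒P′ Q⇒Q′ R⇒R′ with column z
    ... | β-column = subst T (sym (setColumns-β R′ P′ Q′ u)) ∘ P⇒P′ refl ∘ subst T (setColumns-β R P Q u)
    ... | γ-column = subst T (sym (setColumns-γ R′ P′ Q′ u)) ∘ Q⇒Q′ refl ∘ subst T (setColumns-γ R P Q u)
    ... | other-column z≢β z≢γ = subst T (sym (setColumns-other R′ P′ Q′ u z≢β z≢γ)) ∘ R⇒R′ z≢β z≢γ
                                   ∘ subst T (setColumns-other R P Q u z≢β z≢γ)

  setColumns-τ : ∀ {m} {R : BipGraph m n} {P Q : Fin m → Bool} u z →
                 setColumns R Q P u (τ z) ≡ setColumns R P Q u z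
  setColumns-τ {R = R} {P} {Q} u z with column z
  ... | β-column =
    trans (cong (setColumns R Q P u) τ-β) (trans (setColumns-γ R Q P u) (sym (setColumns-β R P Q u)))
  ... | γ-column =
    trans (cong (setColumns R Q P u) τ-γ) (trans (setColumns-β R Q P u) (sym (setColumns-γ R P Q u)))
  ... | other-column z≢β z≢γ = trans (cong (setColumns R Q P u) (τ-other z≢β z≢γ))
    (trans (setColumns-other R Q P u z≢β z≢γ) (sym (setColumns-other R P Q u z≢β z≢γ)))

  UPerfectMatching-swapColumns : ∀ {m} {R : BipGraph m n} {P Q : Fin m → Bool} →
    UPerfectMatching (setColumns R P Q) → UPerfectMatching (setColumns R Q P)
  UPerfectMatching-swapColumns {R = R} {P} {Q} (matching f f-injective f-adjacent) =
    matching (τ ∘ f) (λ u v → f-injective u v ∘ τ-injective)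
             (λ u → subst T (sym (setColumns-τ {R = R} {P} {Q} u (f u))) (f-adjacent u))
    where
    τ-injective : ∀ {z z′} → τ z ≡ τ z′ → z ≡ z′
    τ-injective {z} {z′} e = trans (sym (τ-involutive z)) (trans (cong τ e) (τ-involutive z′))

  pairMatchable : ∀ {m} → BipGraph m n → Maybe (Fin m) → Maybe (Fin m) → Bool
  pairMatchable R o₁ o₂ = hasUPerfectMatching (setColumns R ⁅ o₁ ⁆ᵒ ⁅ o₂ ⁆ᵒ)

  pairMatchable-sym : ∀ {m} (R : BipGraph m n) o₁ o₂ → pairMatchable R o₁ o₂ ≡ pairMatchable R o₂ o₁
  pairMatchable-sym R o₁ o₂ = T⇔→≡ (swap {o₁} {o₂}) (swap {o₂} {o₁})
    where
    swap : ∀ {o o′} → T (pairMatchable R o o′) → T (pairMatchable R o′ o)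
    swap {o} {o′} = from (hasUPerfectMatching⇔ {L = setColumns R ⁅ o′ ⁆ᵒ ⁅ o ⁆ᵒ})
                  ∘ UPerfectMatching-swapColumns {R = R} {⁅ o ⁆ᵒ} {⁅ o′ ⁆ᵒ}
                  ∘ to (hasUPerfectMatching⇔ {L = setColumns R ⁅ o ⁆ᵒ ⁅ o′ ⁆ᵒ})

  pairMatchable-cong : ∀ {m} {R R′ : BipGraph m n} → (∀ u z → z ≢ β → z ≢ γ → R u z ≡ R′ u z) →
                       ∀ o₁ o₂ → pairMatchable R o₁ o₂ ≡ pairMatchable R′ o₁ o₂
  pairMatchable-cong R≗R′ o₁ o₂ = T⇔→≡
    (transport (λ u z z≢β z≢γ → subst T (R≗R′ u z z≢β z≢γ)))
    (transport (λ u z z≢β z≢γ → subst T (sym (R≗R′ u z z≢β z≢γ))))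
    where
    transport : ∀ {R R′ : BipGraph _ n} → (∀ u z → z ≢ β → z ≢ γ → T (R u z) → T (R′ u z)) →
                T (pairMatchable R o₁ o₂) → T (pairMatchable R′ o₁ o₂)
    transport {R} {R′} R⇒R′ = from (hasUPerfectMatching⇔ {L = setColumns R′ ⁅ o₁ ⁆ᵒ ⁅ o₂ ⁆ᵒ})
      ∘ UPerfectMatching-mono (λ u z →
          setColumns-⊆ {R = R} {R′} {⁅ o₁ ⁆ᵒ} {⁅ o₁ ⁆ᵒ} {⁅ o₂ ⁆ᵒ} {⁅ o₂ ⁆ᵒ} u z (λ _ → id) (λ _ → id) (R⇒R′ u z))
      ∘ to (hasUPerfectMatching⇔ {L = setColumns R ⁅ o₁ ⁆ᵒ ⁅ o₂ ⁆ᵒ})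

  module _ {m} {R : BipGraph m n} {P Q : Fin m → Bool} where

    UPerfectMatching⇔Completable : UPerfectMatching (setColumns R P Q) ⇔ Completable (pairMatchable R) P Q
    UPerfectMatching⇔Completable = mk⇔ split join
      where
      split : UPerfectMatching (setColumns R P Q) → Completable (pairMatchable R) P Q
      split (matching f f-injective f-adjacent)
        with preimage f f-injective β | preimage f f-injective γ
      ... | o₁ , →o₁ , o₁→ | o₂ , →o₂ , o₂→ =
        completion {β-partner = o₁} {o₂}
          (from (∈ᵒ⇔⁅⁆ᵒ⊆ o₁) λ u u∈ → subst T (setColumns-β R P Q u) (adjacent-at u (o₁→ u u∈)))
          (from (∈ᵒ⇔⁅⁆ᵒ⊆ o₂) λ u u∈ → subst T (setColumns-γ R P Q u) (adjacent-at u (o₂→ u u∈)))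
          (from (hasUPerfectMatching⇔ {L = setColumns R ⁅ o₁ ⁆ᵒ ⁅ o₂ ⁆ᵒ}) (matching f f-injective λ u →
            setColumns-⊆ {R = R} {R} {P} {⁅ o₁ ⁆ᵒ} {Q} {⁅ o₂ ⁆ᵒ} u (f u)
              (λ fu≡β _ → →o₁ u fu≡β) (λ fu≡γ _ → →o₂ u fu≡γ) (λ _ _ → id) (f-adjacent u)))
        where
        adjacent-at : ∀ u {z} → f u ≡ z → T (setColumns R P Q u z)
        adjacent-at u refl = f-adjacent u
      join : Completable (pairMatchable R) P Q → UPerfectMatching (setColumns R P Q)
      join (completion {o₁} {o₂} o₁∈P o₂∈Q k) = UPerfectMatching-mono
        (λ u z → setColumns-⊆ {R = R} {R} {⁅ o₁ ⁆ᵒ} {P} {⁅ o₂ ⁆ᵒ} {Q} u z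
          (λ _ → to (∈ᵒ⇔⁅⁆ᵒ⊆ o₁) o₁∈P u) (λ _ → to (∈ᵒ⇔⁅⁆ᵒ⊆ o₂) o₂∈Q u) (λ _ _ → id))
        (to (hasUPerfectMatching⇔ {L = setColumns R ⁅ o₁ ⁆ᵒ ⁅ o₂ ⁆ᵒ}) k)

  swapIf : Bool → Fin n → Fin n
  swapIf b z = if b then τ z else z

  swapIf-involutive : ∀ b → Involutive _≡_ (swapIf b)
  swapIf-involutive true  = τ-involutive
  swapIf-involutive false _ = refl

  swapIf-other : ∀ b {z} → z ≢ β → z ≢ γ → swapIf b z ≡ z
  swapIf-other true  = τ-other
  swapIf-other false _ _ = refl

  module _ {m} (B : BipGraph m n) (u : Fin m) where
    private
      Bβ∨Bγ Bβ∧Bγ : Fin m → Bool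
      Bβ∨Bγ v = B v β ∨ B v γ
      Bβ∧Bγ v = B v β ∧ B v γ

    shift-transposes : (T (B u β) → T (B u γ)) → ∀ z → shift B β γ u (τ z) ≡ B u z
    shift-transposes β⇒γ z with column z
    ... | β-column = trans (cong (shift B β γ u) τ-β) (trans (setColumns-γ B Bβ∨Bγ Bβ∧Bγ u) (∧-of-⇒ β⇒γ))
    ... | γ-column = trans (cong (shift B β γ u) τ-γ) (trans (setColumns-β B Bβ∨Bγ Bβ∧Bγ u) (∨-of-⇒ β⇒γ))
    ... | other-column z≢β z≢γ =
      trans (cong (shift B β γ u) (τ-other z≢β z≢γ)) (setColumns-other B Bβ∨Bγ Bβ∧Bγ u z≢β z≢γ)

    shift-fixes : (T (B u γ) → T (B u β)) → ∀ z → shift B β γ u z ≡ B u z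
    shift-fixes γ⇒β z with column z
    ... | β-column = trans (setColumns-β B Bβ∨Bγ Bβ∧Bγ u) (trans (∨-comm (B u β) (B u γ)) (∨-of-⇒ γ⇒β))
    ... | γ-column = trans (setColumns-γ B Bβ∨Bγ Bβ∧Bγ u) (trans (∧-comm (B u β) (B u γ)) (∧-of-⇒ γ⇒β))
    ... | other-column z≢β z≢γ = setColumns-other B Bβ∨Bγ Bβ∧Bγ u z≢β z≢γ

    shift-swapIf : ∀ b → (T b → T (B u β) → T (B u γ)) → (¬ T b → T (B u γ) → T (B u β)) →
                   ∀ z → shift B β γ u (swapIf b z) ≡ B u z
    shift-swapIf true  β⇒γ _ = shift-transposes (β⇒γ _)
    shift-swapIf false _ γ⇒β = shift-fixes (γ⇒β λ ())

    swapIf-fixes : ∀ b → (T b → B u β ≡ B u γ) → ∀ z → B u (swapIf b z) ≡ B u z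
    swapIf-fixes false _ _ = refl
    swapIf-fixes true β≡γ z with column z
    ... | β-column = trans (cong (B u) τ-β) (sym (β≡γ _))
    ... | γ-column = trans (cong (B u) τ-γ) (β≡γ _)
    ... | other-column z≢β z≢γ = cong (B u) (τ-other z≢β z≢γ)

  module _ {m} (R : BipGraph m n) (b : Fin m → Bool) where

    swappedColumnβ swappedColumnγ : Fin m → Bool
    swappedColumnβ v = if b v then R v γ else R v β
    swappedColumnγ v = if b v then R v β else R v γ

    swapIf-setColumns : ∀ u z → R u (swapIf (b u) z) ≡ setColumns R swappedColumnβ swappedColumnγ u z
    swapIf-setColumns u z with column z
    ... | β-column = trans (at-β (b u)) (sym (setColumns-β R swappedColumnβ swappedColumnγ u))
      where
      at-β : ∀ c → R u (swapIf c β) ≡ (if c then R u γ else R u β)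
      at-β true  = cong (R u) τ-β
      at-β false = refl
    ... | γ-column = trans (at-γ (b u)) (sym (setColumns-γ R swappedColumnβ swappedColumnγ u))
      where
      at-γ : ∀ c → R u (swapIf c γ) ≡ (if c then R u β else R u γ)
      at-γ true  = cong (R u) τ-γ
      at-γ false = refl
    ... | other-column z≢β z≢γ = trans (cong (R u) (swapIf-other (b u) z≢β z≢γ))
      (sym (setColumns-other R swappedColumnβ swappedColumnγ u z≢β z≢γ))

  hasUPerfectMatching⇔Completable : ∀ {m} {L R : BipGraph m n} {P Q : Fin m → Bool} →
    (∀ u z → L u z ≡ setColumns R P Q u z) → T (hasUPerfectMatching L) ⇔ Completable (pairMatchable R) P Q
  hasUPerfectMatching⇔Completable {L = L} L≗ = mk⇔
    (to UPerfectMatching⇔Completable ∘ UPerfectMatching-mono (λ u z → subst T (L≗ u z))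
      ∘ to hasUPerfectMatching⇔)
    (from (hasUPerfectMatching⇔ {L = L}) ∘ UPerfectMatching-mono (λ u z → subst T (sym (L≗ u z)))
      ∘ from UPerfectMatching⇔Completable)

  flipRows : ∀ {m} → (Fin m → Bool) → Choice m n → Choice m n
  flipRows b N = tabulate λ u → tabulate λ z → graphOf N u (swapIf (b u) z)

  graphOf-flipRows : ∀ {m} (b : Fin m → Bool) N u z →
                     graphOf (flipRows b N) u z ≡ graphOf N u (swapIf (b u) z)
  graphOf-flipRows b N u z = trans (cong (λ row → lookup row z) (lookup∘tabulate _ u)) (lookup∘tabulate _ z)

  flipRows-involutive : ∀ {m} {b b′ : Fin m → Bool} → (∀ u → b′ u ≡ b u) →
                        ∀ N → flipRows b′ (flipRows b N) ≡ N
  flipRows-involutive {b = b} {b′} b′≗b N = graphOf-injective λ u z → begin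
    graphOf (flipRows b′ (flipRows b N)) u z      ≡⟨ graphOf-flipRows b′ (flipRows b N) u z ⟩
    graphOf (flipRows b N) u (swapIf (b′ u) z)    ≡⟨ graphOf-flipRows b N u _ ⟩
    graphOf N u (swapIf (b u) (swapIf (b′ u) z))
      ≡⟨ cong (λ c → graphOf N u (swapIf (b u) (swapIf c z))) (b′≗b u) ⟩
    graphOf N u (swapIf (b u) (swapIf (b u) z))   ≡⟨ cong (graphOf N u) (swapIf-involutive (b u) z) ⟩
    graphOf N u z                                 ∎
    where open ≡-Reasoning

  validChoice-flipRows : ∀ {m} {G₁ G₂ : BipGraph m n} (s : Fin m → ℕ) (b : Fin m → Bool) →
    (∀ u z → G₂ u (swapIf (b u) z) ≡ G₁ u z) →
    ∀ N → validChoice G₂ s (flipRows b N) ≡ validChoice G₁ s N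
  validChoice-flipRows {G₁ = G₁} {G₂} s b G₂≗G₁ N =
    allᶠ-cong λ u → cong₂ _∧_ (within u) (cong (λ c → ⌊ c ℕ.≟ s u ⌋) (size u))
    where
    open ≡-Reasoning
    within : ∀ u → allᶠ (λ z → not (graphOf (flipRows b N) u z) ∨ G₂ u z) ≡
                   allᶠ (λ z → not (graphOf N u z) ∨ G₁ u z)
    within u = begin
      allᶠ (λ z → not (graphOf (flipRows b N) u z) ∨ G₂ u z)
        ≡⟨ allᶠ-cong (λ z → cong (λ x → not x ∨ G₂ u z) (graphOf-flipRows b N u z)) ⟩
      allᶠ (λ z → not (graphOf N u (π z)) ∨ G₂ u z)
        ≡⟨ allᶠ-involution {π = π} (swapIf-involutive (b u)) _ ⟩
      allᶠ (λ z → not (graphOf N u (π (π z))) ∨ G₂ u (π z))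
        ≡⟨ allᶠ-cong (λ z → cong₂ (λ x y → not x ∨ y)
                                  (cong (graphOf N u) (swapIf-involutive (b u) z)) (G₂≗G₁ u z)) ⟩
      allᶠ (λ z → not (graphOf N u z) ∨ G₁ u z) ∎
      where π = swapIf (b u)
    size : ∀ u → countᶠ (graphOf (flipRows b N) u) ≡ countᶠ (graphOf N u)
    size u = trans (count-cong (graphOf-flipRows b N u) (allFin _))
                   (sym (countᶠ-involution {π = swapIf (b u)} (swapIf-involutive (b u)) (graphOf N u)))

  flipRows-∩ : ∀ {m} {F₁ F₂ : BipGraph m n} (b : Fin m → Bool) N →
    (∀ u z → F₂ u (swapIf (b u) z) ≡ F₁ u z) →
    ∀ u z → (graphOf (flipRows b N) ∩ᴳ F₂) u z ≡ (graphOf N ∩ᴳ F₁) u (swapIf (b u) z)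
  flipRows-∩ {F₁ = F₁} {F₂} b N F₂≗F₁ u z = cong₂ _∧_ (graphOf-flipRows b N u z)
    (trans (cong (F₂ u) (sym (swapIf-involutive (b u) z))) (F₂≗F₁ u (swapIf (b u) z)))

-- The coupling

-- x, y are the β- and γ-entries of N(u); fβ, fγ, gγ are F u β, F u γ, G u γ.
swapped-shiftColumnβ : ∀ x y fβ fγ gγ → (T fγ → T gγ) →
  (if not fβ ∧ gγ then y ∧ fγ else x ∧ fβ) ≡ (x ∧ fβ) ∨ (not fβ ∧ (y ∧ fγ))
swapped-shiftColumnβ x y true  fγ    gγ    _ = sym (∨-identityʳ (x ∧ true))
swapped-shiftColumnβ x y false fγ    true  _ = cong (_∨ (y ∧ fγ)) (sym (∧-zeroʳ x))
swapped-shiftColumnβ x y false false false _ = trans (∧-zeroʳ x) (sym (cong₂ _∨_ (∧-zeroʳ x) (∧-zeroʳ y)))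
swapped-shiftColumnβ x y false true  false fγ⇒gγ = ⊥-elim (fγ⇒gγ _)

swapped-shiftColumnγ : ∀ x y fβ fγ gγ → (T fγ → T gγ) →
  (if not fβ ∧ gγ then x ∧ fβ else y ∧ fγ) ≡ fβ ∧ (y ∧ fγ)
swapped-shiftColumnγ x y true  fγ    gγ    _ = refl
swapped-shiftColumnγ x y false fγ    true  _ = ∧-zeroʳ x
swapped-shiftColumnγ x y false false false _ = ∧-zeroʳ y
swapped-shiftColumnγ x y false true  false fγ⇒gγ = ⊥-elim (fγ⇒gγ _)

module Coupling {m n} (G F : BipGraph m n) (F⊆G : F ⊆ᴳ G) (β γ : Fin n) (β≢γ : β ≢ γ) (s : Fin m → ℕ) where
  open Columns β γ β≢γ

  G′ F′ : BipGraph m n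
  G′ = shift G β γ
  F′ = shift F β γ

  F⇒G : ∀ u z → T (F u z) → T (G u z)
  F⇒G u z = from T-≡ ∘ F⊆G u z ∘ to T-≡

  L : Choice m n → BipGraph m n
  L N = graphOf N ∩ᴳ F

  P Q : Choice m n → Fin m → Bool
  P N u = L N u β
  Q N u = L N u γ

  p q : Fin m → Bool
  p u = F u β
  q u = F u γ

  K : Choice m n → Maybe (Fin m) → Maybe (Fin m) → Bool
  K N = pairMatchable (L N)

  L-matchable⇔ : ∀ N → T (hasUPerfectMatching (L N)) ⇔ Completable (K N) (P N) (Q N)
  L-matchable⇔ N = hasUPerfectMatching⇔Completable (swapIf-setColumns (L N) (λ _ → false))

  -- On these rows both G′ and F′ are the rows of G and F with β and γ exchanged, and elsewhere
  -- they agree with G and F, so Φ turns outcomes for G into outcomes for G′ and L into L′.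
  γ-moves : Fin m → Bool
  γ-moves u = not (F u β) ∧ G u γ

  ¬γ-moves⇒Fβ : ∀ u → ¬ T (γ-moves u) → T (G u γ) → T (F u β)
  ¬γ-moves⇒Fβ u stays with F u β
  ... | true  = λ _ → _
  ... | false = ⊥-elim ∘ stays

  Φ : Choice m n → Choice m n
  Φ = flipRows γ-moves

  Φ-involutive : ∀ N → Φ (Φ N) ≡ N
  Φ-involutive = flipRows-involutive (λ _ → refl)

  validChoice-Φ : ∀ N → validChoice G′ s (Φ N) ≡ validChoice G s N
  validChoice-Φ = validChoice-flipRows s γ-moves λ u →
    shift-swapIf G u (γ-moves u) (λ moves _ → proj₂ (to (T-∧ {not (F u β)}) moves))
                                 (λ stays → F⇒G u β ∘ ¬γ-moves⇒Fβ u stays)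

  F′-swapIf-γ-moves : ∀ u z → F′ u (swapIf (γ-moves u) z) ≡ F u z
  F′-swapIf-γ-moves u = shift-swapIf F u (γ-moves u)
    (λ moves fβ → ⊥-elim (to T-not (proj₁ (to (T-∧ {not (F u β)}) moves)) fβ))
    (λ stays → ¬γ-moves⇒Fβ u stays ∘ F⇒G u γ)

  L′-matchable⇔ : ∀ N → T (hasUPerfectMatching (graphOf (Φ N) ∩ᴳ F′)) ⇔
                        Completable (K N) (shiftColumnβ p (P N) (Q N)) (shiftColumnγ p (Q N))
  L′-matchable⇔ N = mk⇔
    (Completable-cong (λ _ _ → refl) columnβ columnγ ∘ to swapped)
    (from swapped ∘ Completable-cong (λ _ _ → refl) (sym ∘ columnβ) (sym ∘ columnγ))
    where
    swapped = hasUPerfectMatching⇔Completable λ u z →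
      trans (flipRows-∩ {F₁ = F} {F₂ = F′} γ-moves N F′-swapIf-γ-moves u z)
            (swapIf-setColumns (L N) γ-moves u z)
    columnβ : ∀ u → swappedColumnβ (L N) γ-moves u ≡ shiftColumnβ p (P N) (Q N) u
    columnβ u = swapped-shiftColumnβ (graphOf N u β) (graphOf N u γ) (F u β) (F u γ) (G u γ) (F⇒G u γ)
    columnγ : ∀ u → swappedColumnγ (L N) γ-moves u ≡ shiftColumnγ p (Q N) u
    columnγ u = swapped-shiftColumnγ (graphOf N u β) (graphOf N u γ) (F u β) (F u γ) (G u γ) (F⇒G u γ)

  module ExchangeAt (N : Choice m n) = Exchange (K N) p q

  exchangeSetOf exchangedβ exchangedγ : Choice m n → Fin m → Bool
  exchangeSetOf N = ExchangeAt.exchangeSet N (P N) (Q N)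
  exchangedβ N = ExchangeAt.exchangeβ N (P N) (Q N)
  exchangedγ N = ExchangeAt.exchangeγ N (P N) (Q N)

  Θ : Choice m n → Choice m n
  Θ N = flipRows (exchangeSetOf N) N

  module _ (N : Choice m n) where

    exchangeSetOf⊆Fβ∩Fγ : ∀ u → T (exchangeSetOf N u) → T (F u β) × T (F u γ)
    exchangeSetOf⊆Fβ∩Fγ u u∈ = fβ , proj₁ (to (T-∧ {F u γ}) rest)
      where
      exchangeable = ExchangeAt.exchangeSet⊆exchangeable N (P N) (Q N) u u∈
      fβ = proj₁ (to (T-∧ {F u β}) exchangeable)
      rest = proj₂ (to (T-∧ {F u β}) exchangeable)

    exchangeSetOf-fixes-rows : ∀ {B : BipGraph m n} → (∀ u → T (F u β) → T (F u γ) → B u β ≡ B u γ) →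
                               ∀ u z → B u (swapIf (exchangeSetOf N u) z) ≡ B u z
    exchangeSetOf-fixes-rows {B} β≡γ u = swapIf-fixes B u (exchangeSetOf N u) λ u∈ →
      let fβ , fγ = exchangeSetOf⊆Fβ∩Fγ u u∈ in β≡γ u fβ fγ

    L-Θ : ∀ u z → L (Θ N) u z ≡ setColumns (L N) (exchangedβ N) (exchangedγ N) u z
    L-Θ u z = trans (flipRows-∩ {F₁ = F} {F₂ = F} (exchangeSetOf N) N
                       (exchangeSetOf-fixes-rows (λ u fβ fγ → trans (to T-≡ fβ) (sym (to T-≡ fγ)))) u z)
                    (swapIf-setColumns (L N) (exchangeSetOf N) u z)

    K-Θ : ∀ o₁ o₂ → K (Θ N) o₁ o₂ ≡ K N o₁ o₂
    K-Θ = pairMatchable-cong λ u z z≢β z≢γ →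
      trans (L-Θ u z) (setColumns-other (L N) (exchangedβ N) (exchangedγ N) u z≢β z≢γ)

    P-Θ : ∀ u → P (Θ N) u ≡ exchangedβ N u
    P-Θ u = trans (L-Θ u β) (setColumns-β (L N) (exchangedβ N) (exchangedγ N) u)

    Q-Θ : ∀ u → Q (Θ N) u ≡ exchangedγ N u
    Q-Θ u = trans (L-Θ u γ) (setColumns-γ (L N) (exchangedβ N) (exchangedγ N) u)

    exchangeSetOf-Θ : ∀ u → exchangeSetOf (Θ N) u ≡ exchangeSetOf N u
    exchangeSetOf-Θ u =
      trans (exchangeSet-cong {p = p} {q} K-Θ P-Θ Q-Θ u) (ExchangeAt.exchangeSet-exchange N (P N) (Q N) u)

    Θ-involutive : Θ (Θ N) ≡ N
    Θ-involutive = flipRows-involutive exchangeSetOf-Θ N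

    validChoice-Θ : validChoice G s (Θ N) ≡ validChoice G s N
    validChoice-Θ = validChoice-flipRows s (exchangeSetOf N)
      (exchangeSetOf-fixes-rows (λ u fβ fγ → trans (to T-≡ (F⇒G u β fβ)) (sym (to T-≡ (F⇒G u γ fγ))))) N

  shiftedGood good : Choice m n → Bool
  shiftedGood N = validChoice G s N ∧ hasUPerfectMatching (graphOf (Φ N) ∩ᴳ F′)
  good N = validChoice G s N ∧ hasUPerfectMatching (L N)

  Θ-maps-shiftedGood∖good : ∀ N → T (shiftedGood N ∧ not (good N)) →
                                  T (good (Θ N) ∧ not (shiftedGood (Θ N)))
  Θ-maps-shiftedGood∖good N t =
    from T-∧ ( from T-∧ (valid-Θ , matchable-Θ)
             , from T-not (unmatchable′-Θ ∘ proj₂ ∘ to (T-∧ {validChoice G s (Θ N)})))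
    where
    shiftedGood-N = proj₁ (to (T-∧ {shiftedGood N}) t)
    valid = proj₁ (to (T-∧ {validChoice G s N}) shiftedGood-N)
    matchable′ = proj₂ (to (T-∧ {validChoice G s N}) shiftedGood-N)
    unmatchable : ¬ Completable (K N) (P N) (Q N)
    unmatchable c = to T-not (proj₂ (to (T-∧ {shiftedGood N}) t)) (from T-∧ (valid , from (L-matchable⇔ N) c))
    Q⊆q : ∀ u → T (Q N u) → T (q u)
    Q⊆q u = proj₂ ∘ to (T-∧ {graphOf N u γ})
    valid-Θ = subst T (sym (validChoice-Θ N)) valid
    matchable-Θ = from (L-matchable⇔ (Θ N))
      (Completable-cong (λ o o′ → sym (K-Θ N o o′)) (sym ∘ P-Θ N) (sym ∘ Q-Θ N)
        (ExchangeAt.exchanged-completable N (pairMatchable-sym (L N)) Q⊆q unmatchable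
          (to (L′-matchable⇔ N) matchable′)))
    unmatchable′-Θ : ¬ T (hasUPerfectMatching (graphOf (Φ (Θ N)) ∩ᴳ F′))
    unmatchable′-Θ m′ =
      ExchangeAt.shifted-exchanged-not-completable N (pairMatchable-sym (L N)) Q⊆q unmatchable
      (Completable-cong (K-Θ N)
        (λ u → cong₂ (λ x y → x ∨ (not (p u) ∧ y)) (P-Θ N u) (Q-Θ N u))
        (λ u → cong (p u ∧_) (Q-Θ N u))
        (to (L′-matchable⇔ (Θ N)) m′))

  goodCount-shift≡ : goodCount G′ F′ s ≡ count shiftedGood (allChoices m n)
  goodCount-shift≡ = trans (count-involution allChoices-unique ∈-allChoices {h = Φ} Φ-involutive _)
    (count-cong (λ N → cong (_∧ hasUPerfectMatching (graphOf (Φ N) ∩ᴳ F′)) (validChoice-Φ N)) (allChoices m n))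

  totalCount-shift≡ : totalCount G′ s ≡ totalCount G s
  totalCount-shift≡ = trans (count-involution allChoices-unique ∈-allChoices {h = Φ} Φ-involutive _)
                            (count-cong validChoice-Φ (allChoices m n))

  shiftedGood≤good : count shiftedGood (allChoices m n) ≤ goodCount G F s
  shiftedGood≤good = count-≤-involution allChoices-unique ∈-allChoices {h = Θ} Θ-involutive
                                        shiftedGood good Θ-maps-shiftedGood∖good

-- The degree bound only makes the probability spaces nonempty; the cross-multiplied
-- inequality holds without it.
corollary9p4 : (m n : ℕ) (G F : BipGraph m n) → F ⊆ᴳ G →
    (β γ : Fin n) → β ≢ γ →
    (s : Fin m → ℕ) → (∀ v → s v ≤ deg G v) →
    goodCount (shift G β γ) (shift F β γ) s * totalCount G s
      ≤ goodCount G F s * totalCount (shift G β γ) s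
corollary9p4 m n G F F⊆G β γ β≢γ s _ = begin
  goodCount G′ F′ s * totalCount G s
    ≡⟨ cong₂ _*_ goodCount-shift≡ (sym totalCount-shift≡) ⟩
  count shiftedGood (allChoices m n) * totalCount G′ s
    ≤⟨ *-monoˡ-≤ (totalCount G′ s) shiftedGood≤good ⟩
  goodCount G F s * totalCount G′ s
    ∎
  where
  open Coupling G F F⊆G β γ β≢γ s
  open ≤-Reasoning
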